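{- If $W=\langle w_1,\dots,w_n\rangle$ is a weave, then the subtournaments $W-\{w_1,w_2\}, W-\{w_2,w_3\},\dots,W-\{w_{n-1},w_n\}$ are all isomorphic to each other. Furthermore, for any $1\le i,j\le n-1$ there is an isomorphism $\phi$ from $W-\{w_i,w_{i+1}\}$ to $W-\{w_j,w_{j+1}\}$ such that whenever $\phi(w_k)=w_\ell$, the integers $k$ and $\ell$ have the same parity.
   Context: A tournament has exactly one directed edge between any two distinct vertices. A weave $\langle w_1,\dots,w_n\rangle$ is a tournament on $w_1,\dots,w_n$ such that: $w_i\to w_j$ whenever $i<j$ and $i,j$ have opposite parity; either $w_i\to w_j$ for all $i<j$ with $i,j$ odd, or $w_j\to w_i$ for all such $i<j$; and either $w_i\to w_j$ for all $i<j$ with $i,j$ even, or $w_j\to w_i$ for all such $i<j$. $W-X$ denotes the subtournament induced on $V(W)\setminus X$. -}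

module Defs where

open import Data.Nat using (ℕ; zero; suc; _<_; _%_)
open import Data.Fin using (Fin; toℕ)
open import Data.Product using (Σ; _×_; proj₁)
open import Data.Sum using (_⊎_)
open import Data.Empty using (⊥)
open import Function.Bundles using (_⇔_)
open import Relation.Binary.PropositionalEquality using (_≡_; _≢_)

record Tournament (n : ℕ) : Set₁ where
  field
    _⇒_     : Fin n → Fin n → Set
    irrefl  : ∀ u → u ⇒ u → ⊥
    total   : ∀ u v → u ≢ v → (u ⇒ v) ⊎ (v ⇒ u)
    asym    : ∀ u v → u ⇒ v → v ⇒ u → ⊥

-- Vertex v : Fin n stands for w_{toℕ v + 1}.  Position k (1-based) of
-- w_{toℕ v + 1} is toℕ v + 1; its parity is that of suc (toℕ v).
parity : ∀ {n} → Fin n → ℕ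
parity v = suc (toℕ v) % 2

record IsWeave {n : ℕ} (T : Tournament n) : Set where
  open Tournament T
  field
    cross : ∀ (i j : Fin n) → toℕ i < toℕ j → parity i ≢ parity j → i ⇒ j
    odds  : (∀ (i j : Fin n) → toℕ i < toℕ j → parity i ≡ 1 → parity j ≡ 1 → i ⇒ j)
          ⊎ (∀ (i j : Fin n) → toℕ i < toℕ j → parity i ≡ 1 → parity j ≡ 1 → j ⇒ i)
    evens : (∀ (i j : Fin n) → toℕ i < toℕ j → parity i ≡ 0 → parity j ≡ 0 → i ⇒ j)
          ⊎ (∀ (i j : Fin n) → toℕ i < toℕ j → parity i ≡ 0 → parity j ≡ 0 → j ⇒ i)

-- Vertex set of W - {w_{i+1}, w_{i+2}} (0-based i, i.e. the vertices
-- whose 0-based index is neither i nor i+1).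
Del : (n i : ℕ) → Set
Del n i = Σ (Fin n) λ v → (toℕ v ≢ i) × (toℕ v ≢ suc i)

record Iso {n : ℕ} (T : Tournament n) (i j : ℕ) : Set where
  open Tournament T
  field
    to      : Del n i → Del n j
    from    : Del n j → Del n i
    from∘to : ∀ x → proj₁ (from (to x)) ≡ proj₁ x
    to∘from : ∀ y → proj₁ (to (from y)) ≡ proj₁ y
    edges   : ∀ x y → (proj₁ x ⇒ proj₁ y) ⇔ (proj₁ (to x) ⇒ proj₁ (to y))

ParityPreserving : ∀ {n} {T : Tournament n} {i j : ℕ} → Iso T i j → Set
ParityPreserving {n} {T} {i} {j} φ = ∀ x → parity (proj₁ x) ≡ parity (proj₁ (Iso.to φ x))

module Submission where

open import Defs
open import Data.Nat using (ℕ; zero; suc; _+_; _<_; _≤_; _%_; z≤n; z<s; s≤s; s≤s⁻¹)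
open import Data.Nat.Properties
  using (<-cmp; <-irrefl; <-asym; ≤-refl; ≤-trans; ≤-<-trans; n≤1+n; +-comm; suc-injective; _≟_)
open import Data.Nat.DivMod using ([m+n]%n≡m%n; m%n<n)
open import Data.Fin using (Fin; toℕ; fromℕ<)
open import Data.Fin.Properties using (toℕ<n; toℕ-fromℕ<; toℕ-injective)
open import Data.Product using (Σ; _×_; _,_; proj₁; proj₂)
open import Data.Sum using (_⊎_; inj₁; inj₂)
import Data.Sum as Sum
open import Data.Empty using (⊥-elim)
open import Function using (_∘_)
open import Function.Bundles using (_⇔_; mk⇔)
open import Relation.Nullary using (yes; no)
open import Relation.Binary.Definitions using (tri<; tri≈; tri>)
open import Relation.Binary.PropositionalEquality

-- In a weave the edge between two vertices depends only on their relative
-- order and their parities.  Deleting the consecutive pair w_{i+1}, w_{i+2}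
-- and renumbering the remaining vertices by rank moves every index by 0 or 2,
-- so renumbering preserves order and parity; composing the renumbering for i
-- with the inverse renumbering for j is therefore an isomorphism.

Avoids : ℕ → ℕ → Set
Avoids i v = (v ≢ i) × (v ≢ suc i)

-- squeeze i is the rank of v in ℕ ∖ {i, i+1}; its values at i and i+1 are junk.
squeeze : ℕ → ℕ → ℕ
squeeze zero    (suc (suc v)) = v
squeeze zero    _             = zero
squeeze (suc i) zero          = zero
squeeze (suc i) (suc v)       = suc (squeeze i v)

unsqueeze : ℕ → ℕ → ℕ
unsqueeze zero    w       = suc (suc w)
unsqueeze (suc j) zero    = zero
unsqueeze (suc j) (suc w) = suc (unsqueeze j w)

avoids-suc : ∀ {i v} → Avoids (suc i) (suc v) → Avoids i v
avoids-suc (v≢i , v≢1+i) = v≢i ∘ cong suc , v≢1+i ∘ cong suc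

unsqueeze-avoids : ∀ j w → Avoids j (unsqueeze j w)
unsqueeze-avoids zero    w       = (λ ()) , (λ ())
unsqueeze-avoids (suc j) zero    = (λ ()) , (λ ())
unsqueeze-avoids (suc j) (suc w) =
  let (≢j , ≢1+j) = unsqueeze-avoids j w in ≢j ∘ suc-injective , ≢1+j ∘ suc-injective

squeeze-unsqueeze : ∀ j w → squeeze j (unsqueeze j w) ≡ w
squeeze-unsqueeze zero    w       = refl
squeeze-unsqueeze (suc j) zero    = refl
squeeze-unsqueeze (suc j) (suc w) = cong suc (squeeze-unsqueeze j w)

unsqueeze-squeeze : ∀ i {v} → Avoids i v → unsqueeze i (squeeze i v) ≡ v
unsqueeze-squeeze zero    {zero}        (v≢0 , _) = ⊥-elim (v≢0 refl)
unsqueeze-squeeze zero    {suc zero}    (_ , v≢1) = ⊥-elim (v≢1 refl)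
unsqueeze-squeeze zero    {suc (suc v)} _         = refl
unsqueeze-squeeze (suc i) {zero}        _         = refl
unsqueeze-squeeze (suc i) {suc v}       av        = cong suc (unsqueeze-squeeze i (avoids-suc av))

squeeze-shift : ∀ i {v} → Avoids i v → v ≡ squeeze i v ⊎ v ≡ 2 + squeeze i v
squeeze-shift zero    {zero}        (v≢0 , _) = ⊥-elim (v≢0 refl)
squeeze-shift zero    {suc zero}    (_ , v≢1) = ⊥-elim (v≢1 refl)
squeeze-shift zero    {suc (suc v)} _         = inj₂ refl
squeeze-shift (suc i) {zero}        _         = inj₁ refl
squeeze-shift (suc i) {suc v}       av        =
  Sum.map (cong suc) (cong suc) (squeeze-shift i (avoids-suc av))

unsqueeze-shift : ∀ j w → unsqueeze j w ≡ w ⊎ unsqueeze j w ≡ 2 + w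
unsqueeze-shift zero    w       = inj₂ refl
unsqueeze-shift (suc j) zero    = inj₁ refl
unsqueeze-shift (suc j) (suc w) = Sum.map (cong suc) (cong suc) (unsqueeze-shift j w)

squeeze-< : ∀ {n} i {v} → suc i < n → v < n → Avoids i v → 2 + squeeze i v < n
squeeze-< zero    {zero}        _  _   (v≢0 , _) = ⊥-elim (v≢0 refl)
squeeze-< zero    {suc zero}    _  _   (_ , v≢1) = ⊥-elim (v≢1 refl)
squeeze-< zero    {suc (suc v)} _  v<n _         = v<n
squeeze-< (suc i) {zero}        hi _   _         = ≤-trans (s≤s (s≤s (s≤s z≤n))) hi
squeeze-< {suc n} (suc i) {suc v} hi v<n av      =
  s≤s (squeeze-< i (s≤s⁻¹ hi) (s≤s⁻¹ v<n) (avoids-suc av))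

unsqueeze-≤ : ∀ j w → unsqueeze j w ≤ 2 + w
unsqueeze-≤ j w with unsqueeze-shift j w
... | inj₁ eq rewrite eq = ≤-trans (n≤1+n w) (n≤1+n (suc w))
... | inj₂ eq rewrite eq = ≤-refl

squeeze-mono : ∀ i {a b} → Avoids i a → Avoids i b → a < b → squeeze i a < squeeze i b
squeeze-mono zero    {zero}        (a≢0 , _) _ _ = ⊥-elim (a≢0 refl)
squeeze-mono zero    {suc zero}    (_ , a≢1) _ _ = ⊥-elim (a≢1 refl)
squeeze-mono zero    {suc (suc a)} {suc zero}    _ _ (s≤s ())
squeeze-mono zero    {suc (suc a)} {suc (suc b)} _ _ a<b = s≤s⁻¹ (s≤s⁻¹ a<b)
squeeze-mono (suc i) {zero}  {suc b} _ _ _ = z<s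
squeeze-mono (suc i) {suc a} {suc b} aa ab a<b =
  s≤s (squeeze-mono i (avoids-suc aa) (avoids-suc ab) (s≤s⁻¹ a<b))

unsqueeze-mono : ∀ j {a b} → a < b → unsqueeze j a < unsqueeze j b
unsqueeze-mono zero    a<b = s≤s (s≤s a<b)
unsqueeze-mono (suc j) {zero}  {suc b} _   = z<s
unsqueeze-mono (suc j) {suc a} {suc b} a<b = s≤s (unsqueeze-mono j (s≤s⁻¹ a<b))

strictMono⇒reflects-< : ∀ {A : ℕ → Set} (f : ℕ → ℕ) →
  (∀ {a b} → A a → A b → a < b → f a < f b) →
  ∀ {a b} → A a → A b → f a < f b → a < b
strictMono⇒reflects-< f mono {a} {b} Aa Ab fa<fb with <-cmp a b
... | tri< a<b _ _  = a<b
... | tri≈ _ refl _ = ⊥-elim (<-irrefl refl fa<fb)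
... | tri> _ _ b<a  = ⊥-elim (<-asym fa<fb (mono Ab Aa b<a))

parityℕ : ℕ → ℕ
parityℕ w = suc w % 2

parityℕ-shift : ∀ {a b} → a ≡ b ⊎ a ≡ 2 + b → parityℕ a ≡ parityℕ b
parityℕ-shift (inj₁ refl) = refl
parityℕ-shift {b = b} (inj₂ refl) = trans (cong (_% 2) (+-comm 2 (suc b))) ([m+n]%n≡m%n (suc b) 2)

relabel : ℕ → ℕ → ℕ → ℕ
relabel i j v = unsqueeze j (squeeze i v)

relabel-mono : ∀ i j {a b} → Avoids i a → Avoids i b → a < b → relabel i j a < relabel i j b
relabel-mono i j aa ab = unsqueeze-mono j ∘ squeeze-mono i aa ab

relabel-parity : ∀ i j {v} → Avoids i v → parityℕ v ≡ parityℕ (relabel i j v)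
relabel-parity i j {v} av =
  trans (parityℕ-shift (squeeze-shift i av)) (sym (parityℕ-shift (unsqueeze-shift j (squeeze i v))))

relabel-inverse : ∀ i j {v} → Avoids i v → relabel j i (relabel i j v) ≡ v
relabel-inverse i j {v} av = begin
  unsqueeze i (squeeze j (unsqueeze j (squeeze i v))) ≡⟨ cong (unsqueeze i) (squeeze-unsqueeze j (squeeze i v)) ⟩
  unsqueeze i (squeeze i v)                             ≡⟨ unsqueeze-squeeze i av ⟩
  v                                                     ∎
  where open ≡-Reasoning

relabelDel : ∀ {n} i j → suc i < n → Del n i → Del n j
relabelDel {n} i j hi (v , av) =
  fromℕ< bound , subst (Avoids j) (sym (toℕ-fromℕ< bound)) (unsqueeze-avoids j _)
  where
  bound : relabel i j (toℕ v) < n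
  bound = ≤-<-trans (unsqueeze-≤ j (squeeze i (toℕ v))) (squeeze-< i hi (toℕ<n v) av)

relabelDel-toℕ : ∀ {n} i j (hi : suc i < n) x →
  toℕ (proj₁ (relabelDel i j hi x)) ≡ relabel i j (toℕ (proj₁ x))
relabelDel-toℕ i j hi (v , _) = toℕ-fromℕ< _

relabelDel-inverse : ∀ {n} i j (hi : suc i < n) (hj : suc j < n) x →
  proj₁ (relabelDel j i hj (relabelDel i j hi x)) ≡ proj₁ x
relabelDel-inverse i j hi hj x@(v , av) = toℕ-injective (begin
  toℕ (proj₁ (relabelDel j i hj (relabelDel i j hi x))) ≡⟨ relabelDel-toℕ j i hj (relabelDel i j hi x) ⟩
  relabel j i (toℕ (proj₁ (relabelDel i j hi x)))       ≡⟨ cong (relabel j i) (relabelDel-toℕ i j hi x) ⟩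
  relabel j i (relabel i j (toℕ v))                     ≡⟨ relabel-inverse i j av ⟩
  toℕ v                                                 ∎)
  where open ≡-Reasoning

relabelDel-parity : ∀ {n} i j (hi : suc i < n) x →
  parity (proj₁ x) ≡ parity (proj₁ (relabelDel i j hi x))
relabelDel-parity i j hi x@(_ , av) =
  trans (relabel-parity i j av) (cong parityℕ (sym (relabelDel-toℕ i j hi x)))

relabelDel-<⇔ : ∀ {n} i j (hi : suc i < n) (x y : Del n i) →
  (toℕ (proj₁ x) < toℕ (proj₁ y) → toℕ (proj₁ (relabelDel i j hi x)) < toℕ (proj₁ (relabelDel i j hi y)))
  × (toℕ (proj₁ (relabelDel i j hi x)) < toℕ (proj₁ (relabelDel i j hi y)) → toℕ (proj₁ x) < toℕ (proj₁ y))
relabelDel-<⇔ i j hi x@(_ , ax) y@(_ , ay) =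
    subst₂ _<_ (sym (relabelDel-toℕ i j hi x)) (sym (relabelDel-toℕ i j hi y)) ∘ relabel-mono i j ax ay
  , strictMono⇒reflects-< (relabel i j) (relabel-mono i j) ax ay
      ∘ subst₂ _<_ (relabelDel-toℕ i j hi x) (relabelDel-toℕ i j hi y)

module WeaveEdges {n : ℕ} {T : Tournament n} (W : IsWeave T) where
  open Tournament T
  open IsWeave W

  Oriented : ℕ → Set
  Oriented p = (∀ (a b : Fin n) → toℕ a < toℕ b → parity a ≡ p → parity b ≡ p → a ⇒ b)
             ⊎ (∀ (a b : Fin n) → toℕ a < toℕ b → parity a ≡ p → parity b ≡ p → b ⇒ a)

  oriented : (a : Fin n) → Oriented (parity a)
  oriented a with parity a | m%n<n (suc (toℕ a)) 2
  ... | zero          | _ = evens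
  ... | suc zero      | _ = odds
  ... | suc (suc _)   | s≤s (s≤s ())

  ascending-edge-transfer : ∀ {a b a' b' : Fin n} → toℕ a < toℕ b → toℕ a' < toℕ b' →
    parity a ≡ parity a' → parity b ≡ parity b' →
    (a ⇒ b → a' ⇒ b') × (b ⇒ a → b' ⇒ a')
  ascending-edge-transfer {a} {b} {a'} {b'} a<b a'<b' pa pb with parity a ≟ parity b
  ... | no pa≢pb =
        (λ _ → cross a' b' a'<b' λ eq → pa≢pb (trans pa (trans eq (sym pb))))
      , (λ b⇒a → ⊥-elim (asym a b (cross a b a<b pa≢pb) b⇒a))
  ... | yes pa≡pb with oriented a
  ...   | inj₁ up =
          (λ _ → up a' b' a'<b' (sym pa) (trans (sym pb) (sym pa≡pb)))
        , (λ b⇒a → ⊥-elim (asym a b (up a b a<b refl (sym pa≡pb)) b⇒a))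
  ...   | inj₂ down =
          (λ a⇒b → ⊥-elim (asym b a (down a b a<b refl (sym pa≡pb)) a⇒b))
        , (λ _ → down a' b' a'<b' (sym pa) (trans (sym pb) (sym pa≡pb)))

  edge-transfer : ∀ {u v u' v' : Fin n} →
    (toℕ u < toℕ v → toℕ u' < toℕ v') → (toℕ v < toℕ u → toℕ v' < toℕ u') →
    parity u ≡ parity u' → parity v ≡ parity v' → u ⇒ v → u' ⇒ v'
  edge-transfer {u} {v} u<v⇒ v<u⇒ pu pv u⇒v with <-cmp (toℕ u) (toℕ v)
  ... | tri< u<v _ _ = proj₁ (ascending-edge-transfer u<v (u<v⇒ u<v) pu pv) u⇒v
  ... | tri≈ _ eq _  = ⊥-elim (irrefl u (subst (u ⇒_) (sym (toℕ-injective eq)) u⇒v))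
  ... | tri> _ _ v<u = proj₂ (ascending-edge-transfer v<u (v<u⇒ v<u) pv pu) u⇒v

  relabelDel-edges : ∀ i j (hi : suc i < n) (x y : Del n i) →
    (proj₁ x ⇒ proj₁ y) ⇔ (proj₁ (relabelDel i j hi x) ⇒ proj₁ (relabelDel i j hi y))
  relabelDel-edges i j hi x y with relabelDel-<⇔ i j hi x y | relabelDel-<⇔ i j hi y x
  ... | (x<y⇒ , ⇒x<y) | (y<x⇒ , ⇒y<x) =
    mk⇔ (edge-transfer x<y⇒ y<x⇒ parity-x parity-y)
        (edge-transfer ⇒x<y ⇒y<x (sym parity-x) (sym parity-y))
    where
    parity-x : parity (proj₁ x) ≡ parity (proj₁ (relabelDel i j hi x))
    parity-x = relabelDel-parity i j hi x
    parity-y : parity (proj₁ y) ≡ parity (proj₁ (relabelDel i j hi y))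
    parity-y = relabelDel-parity i j hi y

weave-relabel-iso : ∀ {n} {T : Tournament n} → IsWeave T →
  (i j : ℕ) → suc i < n → suc j < n → Σ (Iso T i j) ParityPreserving
weave-relabel-iso W i j hi hj = record
  { to      = relabelDel i j hi
  ; from    = relabelDel j i hj
  ; from∘to = relabelDel-inverse i j hi hj
  ; to∘from = relabelDel-inverse j i hj hi
  ; edges   = WeaveEdges.relabelDel-edges W i j hi
  } , relabelDel-parity i j hi

corollary3p5 : (n : ℕ) (T : Tournament n) → IsWeave T →
    (i j : ℕ) → suc i < n → suc j < n →
    Iso T i j × Σ (Iso T i j) ParityPreserving
corollary3p5 n T W i j hi hj = proj₁ φ , φ
  where
  φ : Σ (Iso T i j) ParityPreserving
  φ = weave-relabel-iso W i j hi hj
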